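{- Let $h \geq 2$ and let $k_0 = \left\lfloor \frac{1}{2^{1/h}-1} \right\rfloor + 1$. Let $r_1 < r_2 < \cdots < r_h$ be pairwise relatively prime positive integers, and let $P$ be a positive integer such that $P \geq r_h - r_1$ and such that, whenever $1 \leq i < j \leq h$ and a prime $p$ divides $r_j - r_i$, $p$ divides $P$. For every positive integer $k$ define $s_{i,k} = kP + r_i$ for $i=1,\ldots,h$, $S_k = \prod_{i=1}^h s_{i,k}$, and $a_{i,k} = S_k / s_{i,k} = \prod_{j \neq i} s_{j,k}$ for $i = 1,\ldots,h$. Then for all $k \geq 1$: (i) the integers $s_{1,k},\ldots,s_{h,k}$ are pairwise relatively prime; (ii) $\gcd(a_{1,k},\ldots,a_{h,k}) = 1$; (iii) $S_k < S_{k+1}$, and if $k \geq k_0$ then $S_{k+1} < 2S_k$.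
   Context: $\lfloor \cdot \rfloor$ denotes the integer part. -}

module Defs where

open import Data.Nat using (ℕ; zero; suc; _+_; _*_; _^_; _≤_; _<_)
open import Data.Nat.GCD using (gcd)
open import Data.Fin using (Fin; punchIn)
open import Data.List using (List; foldr; tabulate)
open import Data.Nat.ListAction using (product)
open import Data.Product using (_×_)

∏ : ∀ {n} → (Fin n → ℕ) → ℕ
∏ f = product (tabulate f)

-- product over j ∈ Fin (suc n) with j ≠ i  (punchIn i enumerates Fin (suc n) ∖ {i})
∏≠ : ∀ {n} → Fin (suc n) → (Fin (suc n) → ℕ) → ℕ
∏≠ i f = ∏ (λ j → f (punchIn i j))

gcdFin : ∀ {n} → (Fin n → ℕ) → ℕ
gcdFin f = foldr gcd 0 (tabulate f)

-- m = ⌊ 1 / (2^{1/h} - 1) ⌋, stated without reals: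
--   m ≤ 1/(2^{1/h}-1)     ⇔  2·m^h ≤ (m+1)^h
--   1/(2^{1/h}-1) < m + 1 ⇔  (m+2)^h < 2·(m+1)^h
IsFloorInvRoot : ℕ → ℕ → Set
IsFloorInvRoot h m = (2 * m ^ h ≤ (suc m) ^ h) × ((suc (suc m)) ^ h < 2 * (suc m) ^ h)

{-# OPTIONS --safe #-}
-- Any prime p dividing s_{i,k} and s_{j,k} (i < j) divides their difference r_j − r_i,
-- hence P and kP, hence r_i and r_j, contradicting coprimality. Each a_{i,k} is then
-- coprime to s_{i,k}, so a common divisor of all the a_{i,k} is coprime to every factor
-- of a_{1,k} while dividing it. For the growth bound, (k+1)·s_{i,k} ≥ k·s_{i,k+1}
-- gives S_{k+1} ≤ ((k+1)/k)^h S_k, and (k+1)/k ≤ (k₀+1)/k₀ < 2^{1/h} for k ≥ k₀.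
module Submission where

open import Defs
open import Data.Nat using (ℕ; zero; suc; _+_; _*_; _∸_; _^_; _≤_; _<_)
open import Data.Nat.Divisibility using (_∣_)
open import Data.Nat.Primality using (Prime)
open import Data.Nat.Coprimality using (Coprime)
open import Data.Fin using (Fin; fromℕ) renaming (zero to fzero; _<_ to _<ᶠ_)
open import Data.Product using (_×_)
open import Relation.Binary.PropositionalEquality using (_≡_; _≢_)

open import Data.Nat using (z<s; >-nonZero)
open import Data.Nat.Properties
open import Data.Nat.Divisibility using (∣-trans; ∣-refl; 0∣⇒≡0; ∣m+n∣m⇒∣n; m∣m*n; ∣n⇒∣m*n; _∣0)
open import Data.Nat.GCD using (gcd[m,n]∣m; gcd[m,n]∣n)
import Data.Nat.Coprimality as Coprime
open import Data.Nat.Primality using (¬prime[1]; prime[2])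
open import Data.Nat.Primality.Factorisation using (factorise)
open import Data.List using ([]; _∷_)
open import Data.List.Relation.Unary.All using (_∷_)
open import Data.Fin using (suc; punchIn)
import Data.Fin.Properties as Fin
open import Data.Product using (_,_)
open import Data.Empty using (⊥; ⊥-elim)
open import Relation.Binary.Definitions using (Symmetric; tri<; tri≈; tri>)
open import Relation.Binary.PropositionalEquality using (refl; sym; trans; cong; subst)
open import Data.Nat.Tactic.RingSolver using (solve-∀)

noCommonPrime⇒coprime : ∀ {m n} → (∀ p → Prime p → p ∣ m → p ∣ n → ⊥) → Coprime m n
noCommonPrime⇒coprime noPrime {zero} (0∣m , 0∣n) =
  ⊥-elim (noPrime 2 prime[2] (subst (2 ∣_) (sym (0∣⇒≡0 0∣m)) (2 ∣0))
                             (subst (2 ∣_) (sym (0∣⇒≡0 0∣n)) (2 ∣0)))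
noCommonPrime⇒coprime noPrime {d@(suc _)} (d∣m , d∣n) with factorise d
... | record { factors = [] ; isFactorisation = d≡1 } = d≡1
... | record { factors = p ∷ _ ; isFactorisation = eq ; factorsPrime = prime-p ∷ _ } =
  ⊥-elim (noPrime p prime-p (∣-trans p∣d d∣m) (∣-trans p∣d d∣n))
  where
  p∣d : p ∣ d
  p∣d = subst (p ∣_) (sym eq) (m∣m*n _)

coprime-+-shift : ∀ {a b} c → a ≤ b → Coprime a b
  → (∀ p → Prime p → p ∣ b ∸ a → p ∣ c) → Coprime (c + a) (c + b)
coprime-+-shift {a} {b} c a≤b a⊥b primesOfGap = noCommonPrime⇒coprime λ p prime-p p∣c+a p∣c+b →
  let c+b≡c+a+gap : c + b ≡ (c + a) + (b ∸ a)
      c+b≡c+a+gap = trans (cong (c +_) (sym (m+[n∸m]≡n a≤b))) (sym (+-assoc c a (b ∸ a)))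
      p∣gap = ∣m+n∣m⇒∣n (subst (p ∣_) c+b≡c+a+gap p∣c+b) p∣c+a
      p∣c = primesOfGap p prime-p p∣gap
  in ¬prime[1] (subst Prime (a⊥b (∣m+n∣m⇒∣n p∣c+a p∣c , ∣m+n∣m⇒∣n p∣c+b p∣c)) prime-p)

coprime-* : ∀ {x a b} → Coprime x a → Coprime x b → Coprime x (a * b)
coprime-* x⊥a x⊥b (d∣x , d∣ab) =
  x⊥b (d∣x , Coprime.coprime-divisor (λ (e∣d , e∣a) → x⊥a (∣-trans e∣d d∣x , e∣a)) d∣ab)

pairwise-<⇒pairwise-≢ : ∀ {n} {R : ℕ → ℕ → Set} (f : Fin n → ℕ) → Symmetric R
  → (∀ i j → i <ᶠ j → R (f i) (f j)) → ∀ i j → i ≢ j → R (f i) (f j)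
pairwise-<⇒pairwise-≢ f R-sym R< i j i≢j with Fin.<-cmp i j
... | tri< i<j _ _ = R< i j i<j
... | tri≈ _ i≡j _ = ⊥-elim (i≢j i≡j)
... | tri> _ _ j<i = R-sym (R< j i j<i)

∏-coprime : ∀ {n} x (f : Fin n → ℕ) → (∀ j → Coprime x (f j)) → Coprime x (∏ f)
∏-coprime {zero}  x f x⊥f = Coprime.sym (Coprime.1-coprimeTo x)
∏-coprime {suc n} x f x⊥f = coprime-* (x⊥f fzero) (∏-coprime x (λ j → f (suc j)) (λ j → x⊥f (suc j)))

∏-pos : ∀ {n} (f : Fin n → ℕ) → (∀ i → 0 < f i) → 0 < ∏ f
∏-pos {zero}  f f>0 = z<s
∏-pos {suc n} f f>0 = *-mono-< (f>0 fzero) (∏-pos (λ j → f (suc j)) (λ j → f>0 (suc j)))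

∏-mono-≤ : ∀ {n} (f g : Fin n → ℕ) → (∀ i → f i ≤ g i) → ∏ f ≤ ∏ g
∏-mono-≤ {zero}  f g f≤g = ≤-refl
∏-mono-≤ {suc n} f g f≤g =
  *-mono-≤ (f≤g fzero) (∏-mono-≤ (λ j → f (suc j)) (λ j → g (suc j)) (λ j → f≤g (suc j)))

∏-mono-< : ∀ {n} (f g : Fin (suc n) → ℕ) → (∀ i → f i < g i) → ∏ f < ∏ g
∏-mono-< f g f<g = begin-strict
  f fzero * ∏ (λ j → f (suc j)) ≤⟨ *-monoʳ-≤ (f fzero) (∏-mono-≤ _ _ (λ j → <⇒≤ (f<g (suc j)))) ⟩
  f fzero * ∏ (λ j → g (suc j)) <⟨ *-monoˡ-< _ {{>-nonZero ∏g₊>0}} (f<g fzero) ⟩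
  g fzero * ∏ (λ j → g (suc j)) ∎
  where
  open ≤-Reasoning
  ∏g₊>0 : 0 < ∏ (λ j → g (suc j))
  ∏g₊>0 = ∏-pos _ (λ j → <-≤-trans z<s (f<g (suc j)))

∏-scale : ∀ {n} (f g : Fin n → ℕ) c d → (∀ i → f i * c ≤ d * g i) → ∏ f * c ^ n ≤ d ^ n * ∏ g
∏-scale {zero}  f g c d fc≤dg = ≤-refl
∏-scale {suc n} f g c d fc≤dg = begin
  (f fzero * ∏ f₊) * (c * c ^ n) ≡⟨ [m*n]*[o*p]≡[m*o]*[n*p] (f fzero) _ c _ ⟩
  (f fzero * c) * (∏ f₊ * c ^ n) ≤⟨ *-mono-≤ (fc≤dg fzero) (∏-scale f₊ g₊ c d (λ j → fc≤dg (suc j))) ⟩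
  (d * g fzero) * (d ^ n * ∏ g₊) ≡⟨ [m*n]*[o*p]≡[m*o]*[n*p] d _ _ _ ⟩
  (d * d ^ n) * (g fzero * ∏ g₊) ∎
  where
  open ≤-Reasoning
  f₊ g₊ : Fin n → ℕ
  f₊ j = f (suc j)
  g₊ j = g (suc j)

gcdFin-∣ : ∀ {n} (f : Fin n → ℕ) i → gcdFin f ∣ f i
gcdFin-∣ f fzero    = gcd[m,n]∣m (f fzero) (gcdFin (λ j → f (suc j)))
gcdFin-∣ f (suc i) =
  ∣-trans (gcd[m,n]∣n (f fzero) (gcdFin (λ j → f (suc j)))) (gcdFin-∣ (λ j → f (suc j)) i)

pairwiseCoprime⇒gcdFin-∏≠≡1 : ∀ {n} (f : Fin (suc n) → ℕ)
  → (∀ i j → i ≢ j → Coprime (f i) (f j)) → gcdFin (λ i → ∏≠ i f) ≡ 1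
pairwiseCoprime⇒gcdFin-∏≠≡1 f f-coprime =
  ∏-coprime g (λ j → f (suc j)) (λ j → g⊥f (suc j)) (∣-refl , gcdFin-∣ cofactor fzero)
  where
  cofactor : Fin _ → ℕ
  cofactor i = ∏≠ i f
  g = gcdFin cofactor
  cofactor⊥f : ∀ i → Coprime (f i) (cofactor i)
  cofactor⊥f i = ∏-coprime (f i) (λ j → f (punchIn i j))
    (λ j → f-coprime i (punchIn i j) (λ i≡ → Fin.punchInᵢ≢i i j (sym i≡)))
  g⊥f : ∀ i → Coprime g (f i)
  g⊥f i (d∣g , d∣fi) = cofactor⊥f i (d∣fi , ∣-trans d∣g (gcdFin-∣ cofactor i))

[m*n]*o≡[m*o]*n : ∀ m n o → (m * n) * o ≡ (m * o) * n
[m*n]*o≡[m*o]*n = solve-∀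

^-distribʳ-* : ∀ h a b → (a * b) ^ h ≡ a ^ h * b ^ h
^-distribʳ-* zero    a b = refl
^-distribʳ-* (suc h) a b =
  trans (cong ((a * b) *_) (^-distribʳ-* h a b)) ([m*n]*[o*p]≡[m*o]*[n*p] a b _ _)

succ-ratio-^ : ∀ h c m k → suc m ≤ k → suc (suc m) ^ h < c * suc m ^ h → suc k ^ h < c * k ^ h
succ-ratio-^ h c m k m<k ratio-m = *-cancelʳ-< (suc m ^ h) (suc k ^ h) (c * k ^ h) (begin-strict
  suc k ^ h * suc m ^ h     ≡⟨ sym (^-distribʳ-* h (suc k) (suc m)) ⟩
  (suc k * suc m) ^ h       ≤⟨ ^-monoˡ-≤ h cross ⟩
  (suc (suc m) * k) ^ h     ≡⟨ ^-distribʳ-* h (suc (suc m)) k ⟩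
  suc (suc m) ^ h * k ^ h   <⟨ *-monoˡ-< (k ^ h) {{>-nonZero (m^n>0 k {{>-nonZero k>0}} h)}} ratio-m ⟩
  (c * suc m ^ h) * k ^ h   ≡⟨ [m*n]*o≡[m*o]*n c (suc m ^ h) (k ^ h) ⟩
  (c * k ^ h) * suc m ^ h   ∎)
  where
  open ≤-Reasoning
  expand-left : ∀ k m → suc k * suc m ≡ suc m * k + suc m
  expand-left = solve-∀
  collect-right : ∀ k m → suc m * k + k ≡ suc (suc m) * k
  collect-right = solve-∀
  k>0 : 0 < k
  k>0 = <-≤-trans z<s m<k
  cross : suc k * suc m ≤ suc (suc m) * k
  cross = begin
    suc k * suc m     ≡⟨ expand-left k m ⟩
    suc m * k + suc m ≤⟨ +-monoʳ-≤ (suc m * k) m<k ⟩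
    suc m * k + k     ≡⟨ collect-right k m ⟩
    suc (suc m) * k   ∎

∏-shift-succ-< : ∀ {h} P (r : Fin h → ℕ) c k → 0 < k → (∀ i → 0 < r i)
  → suc k ^ h < c * k ^ h → ∏ (λ i → suc k * P + r i) < c * ∏ (λ i → k * P + r i)
∏-shift-succ-< {h} P r c k k>0 r>0 ratio-k = *-cancelʳ-< (k ^ h) _ _ (begin-strict
  ∏ s₊ * k ^ h         ≤⟨ ∏-scale s₊ s k (suc k) s₊-scale ⟩
  suc k ^ h * ∏ s      <⟨ *-monoˡ-< (∏ s) {{>-nonZero ∏s>0}} ratio-k ⟩
  (c * k ^ h) * ∏ s    ≡⟨ [m*n]*o≡[m*o]*n c (k ^ h) (∏ s) ⟩
  (c * ∏ s) * k ^ h    ∎)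
  where
  open ≤-Reasoning
  s s₊ : Fin h → ℕ
  s i = k * P + r i
  s₊ i = suc k * P + r i
  ∏s>0 : 0 < ∏ s
  ∏s>0 = ∏-pos s (λ i → <-≤-trans (r>0 i) (m≤n+m (r i) (k * P)))
  expand : ∀ k P r → (suc k * P + r) * k + r ≡ suc k * (k * P + r)
  expand = solve-∀
  s₊-scale : ∀ i → s₊ i * k ≤ suc k * s i
  s₊-scale i = begin
    s₊ i * k         ≤⟨ m≤m+n _ (r i) ⟩
    s₊ i * k + r i   ≡⟨ expand k P (r i) ⟩
    suc k * s i      ∎

lemma1 : (n : ℕ) → 1 ≤ n
    → (m : ℕ) → IsFloorInvRoot (suc n) m
    → (r : Fin (suc n) → ℕ)
    → (∀ i → 0 < r i)
    → (∀ i j → i <ᶠ j → r i < r j)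
    → (∀ i j → i ≢ j → Coprime (r i) (r j))
    → (P : ℕ) → 0 < P
    → r (fromℕ n) ∸ r fzero ≤ P
    → (∀ i j → i <ᶠ j → ∀ p → Prime p → p ∣ (r j ∸ r i) → p ∣ P)
    → ∀ k → 1 ≤ k
    → let s = λ (k : ℕ) (i : Fin (suc n)) → k * P + r i
          S = λ (k : ℕ) → ∏ (s k)
          a = λ (k : ℕ) (i : Fin (suc n)) → ∏≠ i (s k)
      in (∀ i j → i ≢ j → Coprime (s k i) (s k j))
         × (gcdFin (a k) ≡ 1)
         × (S k < S (suc k))
         × (suc m ≤ k → S (suc k) < 2 * S k)
lemma1 n _ m (_ , ratio-m) r r>0 r-increasing r-coprime P P>0 _ gapPrimes∣P k k≥1 =
  s-coprime , pairwiseCoprime⇒gcdFin-∏≠≡1 (s k) s-coprime , S-increasing ,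
  λ m<k → ∏-shift-succ-< P r 2 k k≥1 r>0 (succ-ratio-^ (suc n) 2 m k m<k ratio-m)
  where
  s : ℕ → Fin (suc n) → ℕ
  s k i = k * P + r i

  s-coprime : ∀ i j → i ≢ j → Coprime (s k i) (s k j)
  s-coprime = pairwise-<⇒pairwise-≢ {R = Coprime} (s k) Coprime.sym λ i j i<j →
    coprime-+-shift (k * P) (<⇒≤ (r-increasing i j i<j)) (r-coprime i j (Fin.<⇒≢ i<j))
      (λ p prime-p p∣gap → ∣n⇒∣m*n k (gapPrimes∣P i j i<j p prime-p p∣gap))

  S-increasing : ∏ (s k) < ∏ (s (suc k))
  S-increasing = ∏-mono-< _ _ λ i → +-monoˡ-< (r i) (*-monoˡ-< P {{>-nonZero P>0}} (n<1+n k))
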